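{- Let $t$, $m$ and $k$ be non-negative integers. The following three sets are pairwise in bijection: (a) the set of $t$-core partitions with $m$ corners such that $h(1,1)<kt$; (b) the set of non-negative integer sequences $(n_0,n_1,\dots,n_{t-1})$ such that $n_0=0$, $n_i\le k$ for all $i$, and $\sum_{i=1}^{t}|n_i-n_{i-1}|=2m$, where one sets $n_t:=0$; (c) the set of cornerless Motzkin paths of length $2m+t-1$ with exactly $t-1$ flat steps that are contained in the strip $0\le y\le k$.
   Context: A partition $\lambda=(\lambda_1,\dots,\lambda_\ell)$ is a non-increasing sequence of positive integers; its Young diagram has $\lambda_i$ left-justified boxes in row $i$. An inner corner is a box whose removal leaves the Young diagram of a partition; $\lambda$ has $m$ corners if its Young diagram has exactly $m$ inner corners. The hook length $h(i,j)$ of the box in position $(i,j)$ is the number of boxes to its right in its row, below it in its column, plus one (the box itself). A partition is a $t$-core if no box of its Young diagram has hook length $t$. (For the empty partition, which has no box $(1,1)$, the condition $h(1,1)<kt$ is regarded as satisfied.) A Motzkin path of length $n$ is a path from $(0,0)$ to $(n,0)$ with steps $u=(1,1)$, $d=(1,-1)$, $f=(1,0)$ staying weakly above the $x$-axis. A peak is a vertex preceded by an up step and followed by a down step; a valley is a vertex preceded by a down step and followed by an up step; a path is cornerless if it has no peaks and no valleys. -}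

module Defs where

open import Level using (0ℓ)
open import Data.Nat using (ℕ; zero; suc; _+_; _*_; _∸_; _≤_; _<_; _<?_; ∣_-_∣)
open import Data.Bool using (if_then_else_)
open import Data.Integer as ℤ using (ℤ; +_; 0ℤ)
open import Data.List using (List; []; _∷_; length; filter)
open import Data.List.Relation.Unary.All using (All)
open import Data.List.Relation.Unary.Linked using (Linked)
open import Data.Vec using (Vec; lookup)
open import Data.Fin using (Fin; toℕ; fromℕ<)
open import Data.Product using (Σ; _×_; proj₁)
open import Relation.Binary.PropositionalEquality using (_≡_; _≢_; refl; sym; trans)
open import Relation.Binary.Bundles using (Setoid)
open import Relation.Nullary using (¬_; does)

SubSetoid : (A : Set) → (A → Set) → Setoid 0ℓ 0ℓ
SubSetoid A P = record
  { Carrier = Σ A P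
  ; _≈_ = λ x y → proj₁ x ≡ proj₁ y
  ; isEquivalence = record { refl = refl ; sym = sym ; trans = trans }
  }

IsPartition : List ℕ → Set
IsPartition λ' = All (0 <_) λ' × Linked (λ a b → b ≤ a) λ'

-- row length λ_{i+1} (0-indexed rows), 0 beyond the last row
part : List ℕ → ℕ → ℕ
part []       _       = 0
part (a ∷ _)  zero    = a
part (_ ∷ as) (suc i) = part as i

colLen : List ℕ → ℕ → ℕ
colLen λ' j = length (filter (j <?_) λ')

Box : List ℕ → ℕ → ℕ → Set
Box λ' i j = j < part λ' i

-- hook length of box (i , j): arm + leg + 1
hook : List ℕ → ℕ → ℕ → ℕ
hook λ' i j = (part λ' i ∸ suc j) + (colLen λ' j ∸ suc i) + 1

IsCore : ℕ → List ℕ → Set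
IsCore t λ' = ∀ i j → Box λ' i j → hook λ' i j ≢ t

-- number of inner corners: the last box of row i is an inner corner
-- iff row i+1 is strictly shorter (row ℓ+1 having length 0)
corners : List ℕ → ℕ
corners []           = 0
corners (a ∷ [])     = 1
corners (a ∷ b ∷ r) = (if does (b <? a) then 1 else 0) + corners (b ∷ r)

-- h(1,1) < k t  (vacuous for the empty partition, which has no box (1,1))
HookBound : ℕ → ℕ → List ℕ → Set
HookBound k t λ' = Box λ' 0 0 → hook λ' 0 0 < k * t

PredA : ℕ → ℕ → ℕ → List ℕ → Set
PredA t m k λ' =
  IsPartition λ' × IsCore t λ' × corners λ' ≡ m × HookBound k t λ'

-- Sequences (n_0, …, n_{t-1}) with n_t := 0.

ext : ∀ {t} → Vec ℕ t → ℕ → ℕ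
ext {t} v i with i <? t
... | Relation.Nullary.yes p = lookup v (fromℕ< p)
... | Relation.Nullary.no _  = 0

sum1 : ℕ → (ℕ → ℕ) → ℕ
sum1 zero    f = 0
sum1 (suc n) f = sum1 n f + f (suc n)

PredB : (t m k : ℕ) → Vec ℕ t → Set
PredB t m k v =
  (∀ (i : Fin t) → toℕ i ≡ 0 → lookup v i ≡ 0) ×
  (∀ (i : Fin t) → lookup v i ≤ k) ×
  sum1 t (λ i → ∣ ext v i - ext v (i ∸ 1) ∣) ≡ 2 * m

data Step : Set where
  u d f : Step

stepZ : Step → ℤ
stepZ u = + 1
stepZ d = ℤ.- (+ 1)
stepZ f = 0ℤ

heightsFrom : ℤ → List Step → List ℤ
heightsFrom h []       = []
heightsFrom h (s ∷ ss) = (h ℤ.+ stepZ s) ∷ heightsFrom (h ℤ.+ stepZ s) ss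

finalHeight : ℤ → List Step → ℤ
finalHeight h []       = h
finalHeight h (s ∷ ss) = finalHeight (h ℤ.+ stepZ s) ss

IsMotzkin : List Step → Set
IsMotzkin p = All (0ℤ ℤ.≤_) (heightsFrom 0ℤ p) × finalHeight 0ℤ p ≡ 0ℤ

InStrip : ℕ → List Step → Set
InStrip k p = All (ℤ._≤ + k) (heightsFrom 0ℤ p)

Cornerless : List Step → Set
Cornerless = Linked (λ a b → ¬ (a ≡ u × b ≡ d) × ¬ (a ≡ d × b ≡ u))

flats : List Step → ℕ
flats []       = 0
flats (u ∷ ss) = flats ss
flats (d ∷ ss) = flats ss
flats (f ∷ ss) = suc (flats ss)

PredC : ℕ → ℕ → ℕ → List Step → Set
PredC t m k p =
  IsMotzkin p × length p ≡ 2 * m + t ∸ 1 × Cornerless p ×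
  flats p ≡ t ∸ 1 × InStrip k p

SetA SetB SetC : ℕ → ℕ → ℕ → Setoid 0ℓ 0ℓ
SetA t m k = SubSetoid (List ℕ) (PredA t m k)
SetB t m k = SubSetoid (Vec ℕ t) (PredB t m k)
SetC t m k = SubSetoid (List Step) (PredC t m k)

{-# OPTIONS --safe #-}

-- A partition λ of length ℓ is encoded by its β-set {λᵢ + ℓ − i}, the hook lengths of its first
-- column; its largest element is h(1,1), and its maximal runs of consecutive elements correspond
-- to the corners of λ. The hooks of the first row are the distances from the largest bead to the
-- gaps below it, so λ is a t-core iff its β-set is closed under x ↦ x − t. Placing the beads
-- p = r + qt < kt on an abacus with t runners and k levels, closedness says that runner r carries
-- the initial segment of n_r beads; runner 0 is empty because 0 is never a bead. A run of beads
-- starts at level q of runner r exactly when n_{r−1} ≤ q < n_r, so λ has Σ max(n_r − n_{r−1}, 0)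
-- corners, which is half the total variation of the closed sequence n_0, …, n_{t−1}, 0. Finally the
-- sequence is drawn as the path that moves monotonically from n_{i−1} to n_i and then takes a flat
-- step (ending with the descent from n_{t−1} to 0); these are exactly the cornerless Motzkin paths
-- in the strip, and their length is the total variation plus t − 1.
module Submission where

open import Defs
open import Data.Bool using (Bool; true; false; T; _∧_; _∨_; not; if_then_else_)
open import Data.Bool.Properties using (∧-identityʳ; ∧-zeroʳ; ∨-zeroʳ)
open import Data.Empty using (⊥-elim)
open import Data.Fin as Fin using (Fin; toℕ; fromℕ<)
open import Data.Fin.Properties using (toℕ<n; fromℕ<-toℕ; toℕ-fromℕ<)
open import Data.Integer as ℤ using (0ℤ)
open import Data.Integer.Properties as ℤ using ()
open import Data.List using (List; []; _∷_; length; replicate; _++_)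
open import Data.List.Properties using (++-identityʳ; length-++; length-replicate; filter-accept; filter-reject; length-filter)
open import Data.List.Relation.Unary.All as All using (All; []; _∷_)
open import Data.List.Relation.Unary.Linked as Linked using (Linked; []; [-]; _∷_)
open import Data.List.Relation.Unary.Linked.Properties using (Linked⇒All)
open import Data.Nat
open import Data.Nat.DivMod
open import Data.Nat.Divisibility using (divides)
open import Data.Nat.Properties
open import Algebra.Properties.CommutativeSemigroup +-commutativeSemigroup using (interchange; xy∙z≈xz∙y; x∙yz≈y∙xz)
open import Data.Nat.Tactic.RingSolver using (solve-∀)
open import Data.Product using (Σ; ∃; _×_; _,_; proj₁; proj₂)
open import Data.Sum using (_⊎_; inj₁; inj₂)
open import Data.Unit using (tt)
open import Data.Vec using (Vec; lookup; tabulate; toList) renaming ([] to []ᵥ; _∷_ to _∷ᵥ_)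
open import Data.Vec.Properties using (lookup∘tabulate; tabulate∘lookup; tabulate-cong; length-toList)
open import Function using (_∘_; case_of_)
open import Function.Bundles using (Bijection)
open import Function.Construct.Composition using (bijection)
open import Relation.Binary.Definitions using (tri<; tri≈; tri>)
open import Relation.Binary.PropositionalEquality
open import Relation.Nullary using (¬_; yes; no; does)

𝟙 : Bool → ℕ
𝟙 true  = 1
𝟙 false = 0

<ᵇ-true : ∀ {m n} → m < n → (m <ᵇ n) ≡ true
<ᵇ-true {zero}  {suc n} _       = refl
<ᵇ-true {suc m} {suc n} (s≤s p) = <ᵇ-true p

<ᵇ-false : ∀ {m n} → n ≤ m → (m <ᵇ n) ≡ false
<ᵇ-false {n = zero}     _       = refl
<ᵇ-false {suc m} {suc n} (s≤s p) = <ᵇ-false p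

<ᵇ-true⇒< : ∀ m n → (m <ᵇ n) ≡ true → m < n
<ᵇ-true⇒< m n e = <ᵇ⇒< m n (subst T (sym e) tt)

<ᵇ-+ : ∀ m n k → (m <ᵇ n) ≡ (m + k <ᵇ n + k)
<ᵇ-+ m n k with m <? n
... | yes m<n = trans (<ᵇ-true m<n) (sym (<ᵇ-true (+-monoˡ-< k m<n)))
... | no  m≮n = trans (<ᵇ-false (≮⇒≥ m≮n)) (sym (<ᵇ-false (+-monoˡ-≤ k (≮⇒≥ m≮n))))

if-then-1-else-0≡𝟙 : ∀ b → (if b then 1 else 0) ≡ 𝟙 b
if-then-1-else-0≡𝟙 true  = refl
if-then-1-else-0≡𝟙 false = refl

≡ᵇ-refl : ∀ m → (m ≡ᵇ m) ≡ true
≡ᵇ-refl zero    = refl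
≡ᵇ-refl (suc m) = ≡ᵇ-refl m

≢⇒≡ᵇ-false : ∀ {m n} → m ≢ n → (m ≡ᵇ n) ≡ false
≢⇒≡ᵇ-false {zero}  {zero}  m≢n = ⊥-elim (m≢n refl)
≢⇒≡ᵇ-false {zero}  {suc n} _   = refl
≢⇒≡ᵇ-false {suc m} {zero}  _   = refl
≢⇒≡ᵇ-false {suc m} {suc n} m≢n = ≢⇒≡ᵇ-false (m≢n ∘ cong suc)

infix 4 _∈ᵇ_
_∈ᵇ_ : ℕ → List ℕ → Bool
x ∈ᵇ []     = false
x ∈ᵇ y ∷ ys = (x ≡ᵇ y) ∨ (x ∈ᵇ ys)

∉ᵇ : ∀ {n xs} → All (n ≢_) xs → (n ∈ᵇ xs) ≡ false
∉ᵇ []           = refl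
∉ᵇ (n≢x ∷ n∉xs) = cong₂ _∨_ (≢⇒≡ᵇ-false n≢x) (∉ᵇ n∉xs)

∉ᵇ-bounded : ∀ {n xs} → All (_< n) xs → (n ∈ᵇ xs) ≡ false
∉ᵇ-bounded = ∉ᵇ ∘ All.map (≢-sym ∘ <⇒≢)

∈ᵇ-bounded : ∀ {n x} xs → All (_< n) xs → (x ∈ᵇ xs) ≡ true → x < n
∈ᵇ-bounded {n} {x} (y ∷ ys) (y<n ∷ ys<n) x∈ with x ≡ᵇ y in x≡ᵇy
... | true  = subst (_< n) (sym (≡ᵇ⇒≡ x y (subst T (sym x≡ᵇy) tt))) y<n
... | false = ∈ᵇ-bounded ys ys<n x∈

StrictlyDecreasing : List ℕ → Set
StrictlyDecreasing = Linked (λ a b → b < a)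

decreasing⇒bounded : ∀ {x xs} → StrictlyDecreasing (x ∷ xs) → All (_< x) xs
decreasing⇒bounded [-]        = []
decreasing⇒bounded (x>y ∷ ys) = Linked⇒All (λ b<a c<b → <-trans c<b b<a) x>y ys

bounded-cons : ∀ {x xs} → All (_< x) xs → StrictlyDecreasing xs → StrictlyDecreasing (x ∷ xs)
bounded-cons []         _  = [-]
bounded-cons (y<x ∷ _) ys = y<x ∷ ys

All-<-weaken : ∀ {m n xs} → m ≤ n → All (_< m) xs → All (_< n) xs
All-<-weaken m≤n = All.map (λ x<m → <-≤-trans x<m m≤n)

filterBelow : (ℕ → Bool) → ℕ → List ℕ
filterBelow P zero    = []
filterBelow P (suc n) = if P n then n ∷ filterBelow P n else filterBelow P n

filterBelow-bounded : ∀ P n → All (_< n) (filterBelow P n)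
filterBelow-bounded P zero = []
filterBelow-bounded P (suc n) with P n
... | true  = ≤-refl ∷ All-<-weaken (n≤1+n n) (filterBelow-bounded P n)
... | false = All-<-weaken (n≤1+n n) (filterBelow-bounded P n)

filterBelow-decreasing : ∀ P n → StrictlyDecreasing (filterBelow P n)
filterBelow-decreasing P zero = []
filterBelow-decreasing P (suc n) with P n
... | true  = bounded-cons (filterBelow-bounded P n) (filterBelow-decreasing P n)
... | false = filterBelow-decreasing P n

filterBelow-positive : ∀ P → P 0 ≡ false → ∀ n → All (0 <_) (filterBelow P n)
filterBelow-positive P P0 zero = []
filterBelow-positive P P0 (suc n) with P n in Pn
... | false = filterBelow-positive P P0 n
filterBelow-positive P P0 (suc zero)    | true with () ← trans (sym Pn) P0
filterBelow-positive P P0 (suc (suc n)) | true = z<s ∷ filterBelow-positive P P0 (suc n)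

filterBelow-cong : ∀ {P Q} n → (∀ p → p < n → P p ≡ Q p) → filterBelow P n ≡ filterBelow Q n
filterBelow-cong zero _ = refl
filterBelow-cong {P} {Q} (suc n) P≗Q
  rewrite P≗Q n ≤-refl | filterBelow-cong {P} {Q} n (λ p p<n → P≗Q p (m≤n⇒m≤1+n p<n)) = refl

∈ᵇ-filterBelow : ∀ P n p → (p ∈ᵇ filterBelow P n) ≡ (P p ∧ (p <ᵇ n))
∈ᵇ-filterBelow P zero p = sym (∧-zeroʳ (P p))
∈ᵇ-filterBelow P (suc n) p with P n in Pn | <-cmp p n
... | true  | tri< p<n _ _
  rewrite ≢⇒≡ᵇ-false (<⇒≢ p<n) | ∈ᵇ-filterBelow P n p | <ᵇ-true p<n | <ᵇ-true (m<n⇒m<1+n p<n) = refl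
... | true  | tri≈ _ refl _ rewrite ≡ᵇ-refl p | <ᵇ-true (n<1+n p) | Pn = refl
... | true  | tri> _ _ p>n
  rewrite ≢⇒≡ᵇ-false (λ e → <⇒≢ p>n (sym e)) | ∈ᵇ-filterBelow P n p
        | <ᵇ-false (<⇒≤ p>n) | <ᵇ-false {p} {suc n} p>n = refl
... | false | tri< p<n _ _ rewrite ∈ᵇ-filterBelow P n p | <ᵇ-true p<n | <ᵇ-true (m<n⇒m<1+n p<n) = refl
... | false | tri≈ _ refl _ rewrite ∈ᵇ-filterBelow P n p | <ᵇ-false {p} {p} ≤-refl | <ᵇ-true (n<1+n p) | Pn = refl
... | false | tri> _ _ p>n rewrite ∈ᵇ-filterBelow P n p | <ᵇ-false (<⇒≤ p>n) | <ᵇ-false {p} {suc n} p>n = refl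

∈ᵇ-filterBelow⁺ : ∀ P n p → P p ≡ true → p < n → (p ∈ᵇ filterBelow P n) ≡ true
∈ᵇ-filterBelow⁺ P n p Pp p<n rewrite ∈ᵇ-filterBelow P n p | Pp | <ᵇ-true p<n = refl

∈ᵇ-filterBelow⁻ : ∀ P n p → (p ∈ᵇ filterBelow P n) ≡ true → P p ≡ true × p < n
∈ᵇ-filterBelow⁻ P n p p∈ with P p | p <ᵇ n in p<ᵇn | ∈ᵇ-filterBelow P n p
... | true | true | _ = refl , <ᵇ-true⇒< p n p<ᵇn
... | true | false | e with () ← trans (sym p∈) e
... | false | _ | e with () ← trans (sym p∈) e

filterBelow-∈ᵇ : ∀ n xs → StrictlyDecreasing xs → All (_< n) xs → filterBelow (_∈ᵇ xs) n ≡ xs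
filterBelow-∈ᵇ zero    []       _  _          = refl
filterBelow-∈ᵇ zero    (_ ∷ _)  _  (() ∷ _)
filterBelow-∈ᵇ (suc n) []       _  _          = filterBelow-∈ᵇ n [] [] []
filterBelow-∈ᵇ (suc n) (x ∷ ys) xs↓ (x<1+n ∷ _) with m<1+n⇒m<n∨m≡n x<1+n
... | inj₂ refl rewrite ≡ᵇ-refl x = cong (x ∷_) (begin
  filterBelow (λ p → (p ≡ᵇ x) ∨ (p ∈ᵇ ys)) x
    ≡⟨ filterBelow-cong x (λ p p<x → cong (_∨ (p ∈ᵇ ys)) (≢⇒≡ᵇ-false (<⇒≢ p<x))) ⟩
  filterBelow (_∈ᵇ ys) x
    ≡⟨ filterBelow-∈ᵇ x ys (Linked.tail xs↓) (decreasing⇒bounded xs↓) ⟩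
  ys ∎)
  where open ≡-Reasoning
... | inj₁ x<n = skip (x<n ∷ All-<-weaken (<⇒≤ x<n) (decreasing⇒bounded xs↓))
  where
  skip : All (_< n) (x ∷ ys) → filterBelow (_∈ᵇ x ∷ ys) (suc n) ≡ x ∷ ys
  skip xs<n rewrite ∉ᵇ-bounded {n} {x ∷ ys} xs<n = filterBelow-∈ᵇ n (x ∷ ys) xs↓ xs<n

-- Finite sums

sumBelow : ℕ → (ℕ → ℕ) → ℕ
sumBelow zero    g = 0
sumBelow (suc n) g = sumBelow n g + g n

sumBelow-cong : ∀ n {g h : ℕ → ℕ} → (∀ i → i < n → g i ≡ h i) → sumBelow n g ≡ sumBelow n h
sumBelow-cong zero    _   = refl
sumBelow-cong (suc n) g≗h = cong₂ _+_ (sumBelow-cong n (λ i i<n → g≗h i (m<n⇒m<1+n i<n))) (g≗h n ≤-refl)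

sumBelow-zero : ∀ n {g : ℕ → ℕ} → (∀ i → i < n → g i ≡ 0) → sumBelow n g ≡ 0
sumBelow-zero zero    _  = refl
sumBelow-zero (suc n) g0 = cong₂ _+_ (sumBelow-zero n (λ i i<n → g0 i (m<n⇒m<1+n i<n))) (g0 n ≤-refl)

sumBelow-+ : ∀ n (g h : ℕ → ℕ) → sumBelow n (λ i → g i + h i) ≡ sumBelow n g + sumBelow n h
sumBelow-+ zero    g h = refl
sumBelow-+ (suc n) g h rewrite sumBelow-+ n g h = interchange (sumBelow n g) (sumBelow n h) (g n) (h n)

sumBelow-suc : ∀ n (g : ℕ → ℕ) → sumBelow (suc n) g ≡ g 0 + sumBelow n (g ∘ suc)
sumBelow-suc zero    g = +-comm 0 (g 0)
sumBelow-suc (suc n) g rewrite sumBelow-suc n g = +-assoc (g 0) _ _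

sumBelow-split : ∀ a b (g : ℕ → ℕ) → sumBelow (a + b) g ≡ sumBelow b g + sumBelow a (λ i → g (i + b))
sumBelow-split zero    b g = sym (+-identityʳ _)
sumBelow-split (suc a) b g rewrite sumBelow-split a b g = +-assoc (sumBelow b g) _ _

sumBelow-blocks : ∀ k t (g : ℕ → ℕ) → sumBelow (k * t) g ≡ sumBelow k (λ q → sumBelow t (λ r → g (r + q * t)))
sumBelow-blocks zero    t g = refl
sumBelow-blocks (suc k) t g rewrite sumBelow-split t (k * t) g | sumBelow-blocks k t g = refl

sumBelow-swap : ∀ k t (h : ℕ → ℕ → ℕ) →
  sumBelow k (λ q → sumBelow t (λ r → h r q)) ≡ sumBelow t (λ r → sumBelow k (h r))
sumBelow-swap zero    t h = sym (sumBelow-zero t (λ _ _ → refl))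
sumBelow-swap (suc k) t h rewrite sumBelow-swap k t h = sym (sumBelow-+ t (λ r → sumBelow k (h r)) (λ r → h r k))

sum1≡sumBelow : ∀ n (g : ℕ → ℕ) → sum1 n g ≡ sumBelow n (g ∘ suc)
sum1≡sumBelow zero    g = refl
sum1≡sumBelow (suc n) g rewrite sum1≡sumBelow n g = refl

count-≤ : ∀ k (Q : ℕ → Bool) → sumBelow k (𝟙 ∘ Q) ≤ k
count-≤ zero    Q = z≤n
count-≤ (suc k) Q with Q k
... | true  = subst (_≤ suc k) (+-comm 1 _) (s≤s (count-≤ k Q))
... | false = subst (_≤ suc k) (sym (+-identityʳ _)) (m≤n⇒m≤1+n (count-≤ k Q))

count-all : ∀ j (Q : ℕ → Bool) → (∀ q → q < j → Q q ≡ true) → sumBelow j (𝟙 ∘ Q) ≡ j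
count-all zero    Q _ = refl
count-all (suc j) Q Q-all rewrite count-all j Q (λ q q<j → Q-all q (m<n⇒m<1+n q<j)) | Q-all j ≤-refl = +-comm j 1

count-<ᵇ : ∀ k a → a ≤ k → sumBelow k (λ q → 𝟙 (q <ᵇ a)) ≡ a
count-<ᵇ zero    zero _ = refl
count-<ᵇ (suc k) a a≤1+k with m≤n⇒m<n∨m≡n a≤1+k
... | inj₂ refl   = count-all (suc k) (_<ᵇ suc k) (λ q q<1+k → <ᵇ-true q<1+k)
... | inj₁ (s≤s a≤k) rewrite count-<ᵇ k a a≤k | <ᵇ-false {k} {a} a≤k = +-identityʳ a

count-between : ∀ k a b → a ≤ k → b ≤ k → sumBelow k (λ q → 𝟙 ((q <ᵇ a) ∧ not (q <ᵇ b))) ≡ a ∸ b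
count-between k a b a≤k b≤k with ≤-total b a
... | inj₁ b≤a = +-cancelˡ-≡ b _ _ (begin
  b + sumBelow k between                            ≡⟨ cong (_+ sumBelow k between) (count-<ᵇ k b b≤k) ⟨
  sumBelow k (λ q → 𝟙 (q <ᵇ b)) + sumBelow k between ≡⟨ sumBelow-+ k _ _ ⟨
  sumBelow k (λ q → 𝟙 (q <ᵇ b) + between q)         ≡⟨ sumBelow-cong k (λ q _ → below-a q) ⟨
  sumBelow k (λ q → 𝟙 (q <ᵇ a))                     ≡⟨ count-<ᵇ k a a≤k ⟩
  a                                                 ≡⟨ m+[n∸m]≡n b≤a ⟨
  b + (a ∸ b)                                       ∎)
  where
  open ≡-Reasoning
  between : ℕ → ℕ
  between q = 𝟙 ((q <ᵇ a) ∧ not (q <ᵇ b))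
  below-a : ∀ q → 𝟙 (q <ᵇ a) ≡ 𝟙 (q <ᵇ b) + between q
  below-a q with <-cmp q b
  ... | tri< q<b _ _ rewrite <ᵇ-true q<b | <ᵇ-true (<-≤-trans q<b b≤a) = refl
  ... | tri≈ _ q≡b _ rewrite <ᵇ-false {q} {b} (≤-reflexive (sym q≡b)) = cong 𝟙 (sym (∧-identityʳ _))
  ... | tri> _ _ q>b rewrite <ᵇ-false (<⇒≤ q>b) = cong 𝟙 (sym (∧-identityʳ _))
... | inj₂ a≤b = trans (sumBelow-zero k (λ q _ → empty q)) (sym (m≤n⇒m∸n≡0 a≤b))
  where
  empty : ∀ q → 𝟙 ((q <ᵇ a) ∧ not (q <ᵇ b)) ≡ 0
  empty q with <-cmp q a
  ... | tri< q<a _ _ rewrite <ᵇ-true q<a | <ᵇ-true (<-≤-trans q<a a≤b) = refl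
  ... | tri≈ _ q≡a _ rewrite <ᵇ-false {q} {a} (≤-reflexive (sym q≡a)) = refl
  ... | tri> _ _ q>a rewrite <ᵇ-false (<⇒≤ q>a) = refl

DownwardClosed : (ℕ → Bool) → Set
DownwardClosed Q = ∀ {q q′} → q′ ≤ q → Q q ≡ true → Q q′ ≡ true

downwardClosed⇒initialSegment : ∀ k Q → DownwardClosed Q →
  ∀ q → q < k → Q q ≡ (q <ᵇ sumBelow k (𝟙 ∘ Q))
downwardClosed⇒initialSegment (suc k) Q Q↓ q q<1+k with Q k in Qk
... | true rewrite count-all k Q (λ q′ q′<k → Q↓ (<⇒≤ q′<k) Qk) | +-comm k 1 | <ᵇ-true q<1+k =
  Q↓ (≤-pred q<1+k) Qk
... | false rewrite +-identityʳ (sumBelow k (𝟙 ∘ Q)) with m<1+n⇒m<n∨m≡n q<1+k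
...   | inj₁ q<k  = downwardClosed⇒initialSegment k Q Q↓ q q<k
...   | inj₂ refl rewrite <ᵇ-false {q} {sumBelow q (𝟙 ∘ Q)} (count-≤ q Q) = Qk

rise : ℕ → (ℕ → ℕ) → ℕ
rise n c = sumBelow n (λ i → c (suc i) ∸ c i)

fall : ℕ → (ℕ → ℕ) → ℕ
fall n c = sumBelow n (λ i → c i ∸ c (suc i))

rise+start≡fall+end : ∀ (c : ℕ → ℕ) n → rise n c + c 0 ≡ fall n c + c n
rise+start≡fall+end c zero    = refl
rise+start≡fall+end c (suc n) = begin
  rise n c + (c (suc n) ∸ c n) + c 0   ≡⟨ xy∙z≈xz∙y (rise n c) _ (c 0) ⟩
  rise n c + c 0 + (c (suc n) ∸ c n)   ≡⟨ cong (_+ (c (suc n) ∸ c n)) (rise+start≡fall+end c n) ⟩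
  fall n c + c n + (c (suc n) ∸ c n)   ≡⟨ +-assoc (fall n c) _ _ ⟩
  fall n c + (c n + (c (suc n) ∸ c n)) ≡⟨ cong (fall n c +_) (m+[n∸m]≡[m∸n]+n (c n) (c (suc n))) ⟩
  fall n c + ((c n ∸ c (suc n)) + c (suc n)) ≡⟨ +-assoc (fall n c) _ _ ⟨
  fall n c + (c n ∸ c (suc n)) + c (suc n) ∎
  where
  open ≡-Reasoning
  m+[n∸m]≡[m∸n]+n : ∀ m n → m + (n ∸ m) ≡ (m ∸ n) + n
  m+[n∸m]≡[m∸n]+n m n with ≤-total m n
  ... | inj₁ m≤n rewrite m≤n⇒m∸n≡0 m≤n = m+[n∸m]≡n m≤n
  ... | inj₂ n≤m rewrite m≤n⇒m∸n≡0 n≤m | m∸n+n≡m n≤m = +-identityʳ m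

∣m-n∣≡[m∸n]+[n∸m] : ∀ m n → ∣ m - n ∣ ≡ (m ∸ n) + (n ∸ m)
∣m-n∣≡[m∸n]+[n∸m] m n with ≤-total m n
... | inj₁ m≤n rewrite m≤n⇒∣m-n∣≡n∸m m≤n | m≤n⇒m∸n≡0 m≤n = refl
... | inj₂ n≤m rewrite m≤n⇒∣n-m∣≡n∸m n≤m | m≤n⇒m∸n≡0 n≤m = sym (+-identityʳ _)

sum1-∣Δ∣≡2*rise : ∀ (c : ℕ → ℕ) n → c 0 ≡ 0 → c n ≡ 0 →
  sum1 n (λ i → ∣ c i - c (i ∸ 1) ∣) ≡ 2 * rise n c
sum1-∣Δ∣≡2*rise c n c0 cn = begin
  sum1 n (λ i → ∣ c i - c (i ∸ 1) ∣)                       ≡⟨ sum1≡sumBelow n _ ⟩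
  sumBelow n (λ i → ∣ c (suc i) - c i ∣)                   ≡⟨ sumBelow-cong n (λ i _ → ∣m-n∣≡[m∸n]+[n∸m] (c (suc i)) (c i)) ⟩
  sumBelow n (λ i → (c (suc i) ∸ c i) + (c i ∸ c (suc i))) ≡⟨ sumBelow-+ n _ _ ⟩
  rise n c + fall n c                                      ≡⟨ cong (rise n c +_) fall≡rise ⟩
  rise n c + rise n c                                      ≡⟨ cong (rise n c +_) (+-identityʳ _) ⟨
  2 * rise n c                                             ∎
  where
  open ≡-Reasoning
  fall≡rise : fall n c ≡ rise n c
  fall≡rise = begin
    fall n c       ≡⟨ +-identityʳ _ ⟨
    fall n c + 0   ≡⟨ cong (fall n c +_) cn ⟨
    fall n c + c n ≡⟨ rise+start≡fall+end c n ⟨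
    rise n c + c 0 ≡⟨ cong (rise n c +_) c0 ⟩
    rise n c + 0   ≡⟨ +-identityʳ _ ⟩
    rise n c       ∎

-- β-sets of partitions

beta : List ℕ → List ℕ
beta []      = []
beta (a ∷ l) = a + length l ∷ beta l

unbeta : List ℕ → List ℕ
unbeta []       = []
unbeta (x ∷ xs) = x ∸ length xs ∷ unbeta xs

IsBetaSet : List ℕ → Set
IsBetaSet xs = StrictlyDecreasing xs × All (0 <_) xs

length-beta : ∀ l → length (beta l) ≡ length l
length-beta []      = refl
length-beta (a ∷ l) = cong suc (length-beta l)

length-unbeta : ∀ xs → length (unbeta xs) ≡ length xs
length-unbeta []       = refl
length-unbeta (x ∷ xs) = cong suc (length-unbeta xs)

unbeta-beta : ∀ l → unbeta (beta l) ≡ l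
unbeta-beta []      = refl
unbeta-beta (a ∷ l) rewrite length-beta l | m+n∸n≡m a (length l) = cong (a ∷_) (unbeta-beta l)

length<head : ∀ x xs → IsBetaSet (x ∷ xs) → length xs < x
length<head x []       (_ , 0<x ∷ _)              = 0<x
length<head x (y ∷ ys) (y<x ∷ xs↓ , _ ∷ 0<ys) = <-≤-trans (s≤s (length<head y ys (xs↓ , 0<ys))) y<x

beta-unbeta : ∀ xs → IsBetaSet xs → beta (unbeta xs) ≡ xs
beta-unbeta []       _                   = refl
beta-unbeta (x ∷ xs) β@(xs↓ , _ ∷ 0<xs)
  rewrite length-unbeta xs | m∸n+n≡m (<⇒≤ (length<head x xs β)) =
  cong (x ∷_) (beta-unbeta xs (Linked.tail xs↓ , 0<xs))

beta-isBetaSet : ∀ l → IsPartition l → IsBetaSet (beta l)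
beta-isBetaSet []          _                                       = [] , []
beta-isBetaSet (a ∷ [])    (0<a ∷ [] , _)                         = [-] , <-≤-trans 0<a (m≤m+n a 0) ∷ []
beta-isBetaSet (a ∷ b ∷ l) (0<a ∷ 0<bl , b≤a ∷ bl↓) with beta-isBetaSet (b ∷ l) (0<bl , bl↓)
... | β↓ , 0<β = next<head ∷ β↓ , <-≤-trans 0<a (m≤m+n a _) ∷ 0<β
  where
  next<head : b + length l < a + suc (length l)
  next<head rewrite +-suc a (length l) = s≤s (+-monoˡ-≤ (length l) b≤a)

unbeta-isPartition : ∀ xs → IsBetaSet xs → IsPartition (unbeta xs)
unbeta-isPartition []       _                     = [] , []
unbeta-isPartition (x ∷ []) (_ , 0<x ∷ [])        = 0<x ∷ [] , [-]
unbeta-isPartition (x ∷ y ∷ ys) β@(y<x ∷ ys↓ , _ ∷ 0<ys)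
  with unbeta-isPartition (y ∷ ys) (ys↓ , 0<ys)
... | 0<λ , λ↓ = m<n⇒0<n∸m (length<head x (y ∷ ys) β) ∷ 0<λ , ∸-monoˡ-≤ (suc (length ys)) y<x ∷ λ↓

runs : List ℕ → ℕ
runs []           = 0
runs (x ∷ [])     = 1
runs (x ∷ y ∷ ys) = 𝟙 (suc y <ᵇ x) + runs (y ∷ ys)

runs-cons-gap : ∀ x ys → All (λ y → suc y < x) ys → runs (x ∷ ys) ≡ 1 + runs ys
runs-cons-gap x []       _           = refl
runs-cons-gap x (y ∷ ys) (1+y<x ∷ _) rewrite <ᵇ-true 1+y<x = refl

runStart : (ℕ → Bool) → ℕ → ℕ
runStart P p = 𝟙 (P p ∧ not (P (p ∸ 1)))

runs-cons-filterBelow : ∀ P → P 0 ≡ false → ∀ n →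
  runs (n ∷ filterBelow P n) ≡ 𝟙 (not (P (n ∸ 1))) + runs (filterBelow P n)
runs-cons-filterBelow P P0 zero rewrite P0 = refl
runs-cons-filterBelow P P0 (suc n) with P n
... | true  rewrite <ᵇ-false {suc n} {suc n} ≤-refl = refl
... | false = runs-cons-gap (suc n) (filterBelow P n) (All.map s≤s (filterBelow-bounded P n))

runs-filterBelow : ∀ P → P 0 ≡ false → ∀ n → runs (filterBelow P n) ≡ sumBelow n (runStart P)
runs-filterBelow P P0 zero = refl
runs-filterBelow P P0 (suc n) with P n
... | true  = trans (runs-cons-filterBelow P P0 n)
                (trans (cong (𝟙 (not (P (n ∸ 1))) +_) (runs-filterBelow P P0 n))
                  (+-comm (𝟙 (not (P (n ∸ 1)))) _))
... | false = trans (runs-filterBelow P P0 n) (sym (+-identityʳ _))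

beta<head : ∀ {a l} → IsPartition (a ∷ l) → All (_< a + length l) (beta l)
beta<head {a} {l} P = decreasing⇒bounded (proj₁ (beta-isBetaSet (a ∷ l) P))

corners≡runs : ∀ l → corners l ≡ runs (beta l)
corners≡runs []          = refl
corners≡runs (a ∷ [])    = refl
corners≡runs (a ∷ b ∷ r) = cong₂ _+_ corner (corners≡runs (b ∷ r))
  where
  corner : (if does (b <? a) then 1 else 0) ≡ 𝟙 (suc (b + length r) <ᵇ a + suc (length r))
  corner rewrite +-suc a (length r) = trans (if-then-1-else-0≡𝟙 (b <ᵇ a)) (cong 𝟙 (<ᵇ-+ b a (length r)))

-- Hook lengths and t-cores

isPartition-tail : ∀ {a l} → IsPartition (a ∷ l) → IsPartition l
isPartition-tail (_ ∷ 0<l , λ↓) = 0<l , Linked.tail λ↓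

rows≤ : ∀ {a l j} → IsPartition (a ∷ l) → a ≤ j → All (_≤ j) (a ∷ l)
rows≤ (_ , λ↓) a≤j = Linked⇒All (λ b≤a c≤b → ≤-trans c≤b b≤a) a≤j λ↓

part≤head : ∀ {a l} → IsPartition (a ∷ l) → ∀ i → part l i ≤ a
part≤head {a} {[]}    _ i = z≤n
part≤head {a} {b ∷ l} (_ , b≤a ∷ _) zero    = b≤a
part≤head {a} {b ∷ l} P@(_ , b≤a ∷ _) (suc i) = ≤-trans (part≤head (isPartition-tail P) i) b≤a

colLen-cons : ∀ {a j} l → j < a → colLen (a ∷ l) j ≡ suc (colLen l j)
colLen-cons {a} {j} l j<a = cong length (filter-accept (j <?_) j<a)

colLen-short : ∀ {j} l → All (_≤ j) l → colLen l j ≡ 0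
colLen-short []      _              = refl
colLen-short {j} (b ∷ l) (b≤j ∷ l≤j) = trans (cong length (filter-reject (j <?_) (≤⇒≯ b≤j))) (colLen-short l l≤j)

colLen-zero : ∀ l → All (0 <_) l → colLen l 0 ≡ length l
colLen-zero []      _           = refl
colLen-zero (a ∷ l) (0<a ∷ 0<l) = trans (colLen-cons l 0<a) (cong suc (colLen-zero l 0<l))

firstRowHook : ℕ → List ℕ → ℕ → ℕ
firstRowHook a l j = (a ∸ suc j) + colLen l j + 1

hook-firstRow : ∀ {a l j} → j < a → hook (a ∷ l) 0 j ≡ firstRowHook a l j
hook-firstRow {a} {l} {j} j<a rewrite colLen-cons l j<a = refl

hook-lowerRow : ∀ {a l i j} → IsPartition (a ∷ l) → j < part l i → hook (a ∷ l) (suc i) j ≡ hook l i j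
hook-lowerRow {a} {l} {i} {j} P j<λᵢ rewrite colLen-cons {a} {j} l (<-≤-trans j<λᵢ (part≤head P i)) = refl

hook-corner : ∀ {a l} → IsPartition (a ∷ l) → hook (a ∷ l) 0 0 ≡ a + length l
hook-corner {suc a} {l} (_ ∷ 0<l , _) rewrite colLen-zero l 0<l = +-comm (a + length l) 1

firstRowHook≤hook-corner : ∀ a l j → j < a → firstRowHook a l j ≤ a + length l
firstRowHook≤hook-corner a l j j<a = begin
  (a ∸ suc j) + colLen l j + 1      ≤⟨ +-monoˡ-≤ 1 (+-monoʳ-≤ (a ∸ suc j) (length-filter (j <?_) l)) ⟩
  (a ∸ suc j) + length l + 1        ≤⟨ +-monoʳ-≤ _ (s≤s z≤n) ⟩
  (a ∸ suc j) + length l + suc j    ≡⟨ xy∙z≈xz∙y (a ∸ suc j) (length l) (suc j) ⟩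
  (a ∸ suc j) + suc j + length l    ≡⟨ cong (_+ length l) (m∸n+n≡m j<a) ⟩
  a + length l                      ∎
  where open ≤-Reasoning

firstRowHook-beyond : ∀ {a j} l → j < a → All (_≤ j) l → firstRowHook a l j + (j + length l) ≡ a + length l
firstRowHook-beyond {a} {j} l j<a l≤j rewrite colLen-short l l≤j = begin
  (a ∸ suc j) + 0 + 1 + (j + length l) ≡⟨ regroup (a ∸ suc j) j (length l) ⟩
  (a ∸ suc j) + suc j + length l       ≡⟨ cong (_+ length l) (m∸n+n≡m j<a) ⟩
  a + length l                         ∎
  where
  open ≡-Reasoning
  regroup : ∀ c j n → c + 0 + 1 + (j + n) ≡ c + suc j + n
  regroup = solve-∀

firstRowHook-cons : ∀ b δ l j → j < b → firstRowHook (b + δ) (b ∷ l) j ≡ firstRowHook b l j + suc δ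
firstRowHook-cons b δ l j j<b rewrite colLen-cons {b} {j} l j<b | +-∸-comm δ j<b =
  regroup (b ∸ suc j) δ (colLen l j)
  where
  regroup : ∀ c δ C → c + δ + suc C + 1 ≡ c + C + 1 + suc δ
  regroup = solve-∀

+-suc-swap : ∀ b n δ → b + n + suc δ ≡ b + δ + suc n
+-suc-swap = solve-∀

shift-≡ : ∀ h x b n δ → h + x ≡ b + n → (h + suc δ) + x ≡ (b + δ) + suc n
shift-≡ h x b n δ e = trans (xy∙z≈xz∙y h (suc δ) x) (trans (cong (_+ suc δ) e) (+-suc-swap b n δ))

unshift-≡ : ∀ h x b n δ → (h + suc δ) + x ≡ (b + δ) + suc n → h + x ≡ b + n
unshift-≡ h x b n δ e =
  +-cancelʳ-≡ (suc δ) _ _ (trans (xy∙z≈xz∙y h x (suc δ)) (trans e (+-suc-swap b δ n)))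

gap⇒firstRowHook : ∀ a l x → IsPartition (a ∷ l) → x < a + length l → (x ∈ᵇ beta l) ≡ false →
  ∃ λ j → j < a × firstRowHook a l j + x ≡ a + length l
gap⇒firstRowHook a [] x P x<a+0 _ =
  x , x<a , subst (λ y → firstRowHook a [] x + y ≡ a + 0) (+-identityʳ x) (firstRowHook-beyond [] x<a [])
  where
  x<a : x < a
  x<a = subst (x <_) (+-identityʳ a) x<a+0
gap⇒firstRowHook a (b ∷ l) x P x<β x∉ with <-cmp x (b + length l)
... | tri≈ _ refl _ rewrite ≡ᵇ-refl (b + length l) with () ← x∉
... | tri> _ _ x>b+n = j , j<a , subst (λ y → firstRowHook a (b ∷ l) j + y ≡ a + suc n) j+1+n≡x
                                   (firstRowHook-beyond (b ∷ l) j<a (rows≤ (isPartition-tail P) b≤j))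
  where
  n : ℕ
  n = length l
  j : ℕ
  j = x ∸ suc n
  j+1+n≡x : j + suc n ≡ x
  j+1+n≡x = m∸n+n≡m (≤-trans (s≤s (m≤n+m n b)) x>b+n)
  b≤j : b ≤ j
  b≤j = +-cancelʳ-≤ (suc n) b j (subst (b + suc n ≤_) (sym j+1+n≡x) (subst (_≤ x) (sym (+-suc b n)) x>b+n))
  j<a : j < a
  j<a = +-cancelʳ-< (suc n) j a (subst (_< a + suc n) (sym j+1+n≡x) x<β)
... | tri< x<b+n _ _ rewrite ≢⇒≡ᵇ-false (<⇒≢ x<b+n)
  with gap⇒firstRowHook b l x (isPartition-tail P) x<b+n x∉ | m≤n⇒∃[o]m+o≡n (Linked.head (proj₂ P))
... | j , j<b , hook+x | δ , refl =
  j , ≤-trans j<b (m≤m+n b δ) ,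
  subst (λ h → h + x ≡ b + δ + suc (length l)) (sym (firstRowHook-cons b δ l j j<b)) (shift-≡ _ x b (length l) δ hook+x)

firstRowHook⇒gap : ∀ a l x j → IsPartition (a ∷ l) → j < a → firstRowHook a l j + x ≡ a + length l →
  (x ∈ᵇ beta l) ≡ false
firstRowHook⇒gap a []      x j P j<a hook+x = refl
firstRowHook⇒gap a (b ∷ l) x j P j<a hook+x with b ≤? j
... | yes b≤j = ∉ᵇ-bounded (b+n<x ∷ All-<-weaken (<⇒≤ b+n<x) (beta<head (isPartition-tail P)))
  where
  n : ℕ
  n = length l
  x≡j+1+n : x ≡ j + suc n
  x≡j+1+n = +-cancelˡ-≡ (firstRowHook a (b ∷ l) j) _ _ (trans hook+x (sym
              (firstRowHook-beyond (b ∷ l) j<a (rows≤ (isPartition-tail P) b≤j))))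
  b+n<x : b + n < x
  b+n<x = subst (b + n <_) (sym x≡j+1+n) (subst (_≤ j + suc n) (+-suc b n) (+-monoˡ-≤ (suc n) b≤j))
... | no b≰j with m≤n⇒∃[o]m+o≡n (Linked.head (proj₂ P))
... | δ , refl = cong₂ _∨_ (≢⇒≡ᵇ-false (<⇒≢ x<b+n)) (firstRowHook⇒gap b l x j (isPartition-tail P) j<b hookᵇ+x)
  where
  j<b : j < b
  j<b = ≰⇒> b≰j
  hookᵇ+x : firstRowHook b l j + x ≡ b + length l
  hookᵇ+x = unshift-≡ _ x b (length l) δ (subst (λ h → h + x ≡ b + δ + suc (length l)) (firstRowHook-cons b δ l j j<b) hook+x)
  x<b+n : x < b + length l
  x<b+n = subst (x <_) hookᵇ+x (+-monoˡ-≤ x (m≤n+m 1 _))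

∸-Closed : ℕ → List ℕ → Set
∸-Closed t xs = ∀ x → (x ∈ᵇ xs) ≡ true → t ≤ x → (x ∸ t ∈ᵇ xs) ≡ true

isCore-tail : ∀ {t a l} → IsPartition (a ∷ l) → IsCore t (a ∷ l) → IsCore t l
isCore-tail {t} P core i j box = subst (_≢ t) (hook-lowerRow P box) (core (suc i) j box)

isCore⇒∸-closed : ∀ t → 0 < t → ∀ l → IsPartition l → IsCore t l → ∸-Closed t (beta l)
isCore⇒∸-closed t 0<t (a ∷ l) P core x x∈ t≤x with x ≡ᵇ a + length l in x≡ᵇβ
... | false rewrite isCore⇒∸-closed t 0<t l (isPartition-tail P) (isCore-tail P core) x x∈ t≤x = ∨-zeroʳ _
... | true with refl ← ≡ᵇ⇒≡ x (a + length l) (subst T (sym x≡ᵇβ) tt) with x ∸ t ∈ᵇ beta l in x-t∈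
...   | true  = ∨-zeroʳ _
...   | false with gap⇒firstRowHook a l (x ∸ t) P (∸-monoʳ-< 0<t t≤x) x-t∈
...     | j , j<a , hook+x-t = ⊥-elim (core 0 j j<a (trans (hook-firstRow j<a) hook≡t))
  where
  hook≡t : firstRowHook a l j ≡ t
  hook≡t = +-cancelʳ-≡ (x ∸ t) _ _ (trans hook+x-t (sym (m+[n∸m]≡n t≤x)))

∸-closed⇒isCore : ∀ t → 0 < t → ∀ l → IsPartition l → ∸-Closed t (beta l) → IsCore t l
∸-closed⇒isCore t 0<t (a ∷ l) P closed zero j j<a hook≡t = case trans (sym β-t∈) β-t∉ of λ ()
  where
  β : ℕ
  β = a + length l
  firstHook≡t : firstRowHook a l j ≡ t
  firstHook≡t = trans (sym (hook-firstRow j<a)) hook≡t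
  t≤β : t ≤ β
  t≤β = subst (_≤ β) firstHook≡t (firstRowHook≤hook-corner a l j j<a)
  β-t∉ : (β ∸ t ∈ᵇ beta l) ≡ false
  β-t∉ = firstRowHook⇒gap a l (β ∸ t) j P j<a (trans (cong (_+ (β ∸ t)) firstHook≡t) (m+[n∸m]≡n t≤β))
  β-t∈ : (β ∸ t ∈ᵇ beta l) ≡ true
  β-t∈ = trans (cong (_∨ (β ∸ t ∈ᵇ beta l)) (sym (≢⇒≡ᵇ-false (<⇒≢ (∸-monoʳ-< 0<t t≤β)))))
               (closed β (cong (_∨ (β ∈ᵇ beta l)) (≡ᵇ-refl β)) t≤β)
∸-closed⇒isCore t 0<t (a ∷ l) P closed (suc i) j box hook≡t =
  ∸-closed⇒isCore t 0<t l (isPartition-tail P) closed′ i j box (trans (sym (hook-lowerRow P box)) hook≡t)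
  where
  β : ℕ
  β = a + length l
  closed′ : ∸-Closed t (beta l)
  closed′ x x∈ t≤x with closed x (trans (cong ((x ≡ᵇ β) ∨_) x∈) (∨-zeroʳ _)) t≤x
  ... | x-t∈ rewrite ≢⇒≡ᵇ-false {x ∸ t} {β} (<⇒≢ (≤-<-trans (m∸n≤m x t)
        (∈ᵇ-bounded (beta l) (beta<head P) x∈))) = x-t∈

-- Sequences and the t-abacus

ext-fromℕ< : ∀ {n} (v : Vec ℕ n) i (i<n : i < n) → ext v i ≡ lookup v (fromℕ< i<n)
ext-fromℕ< {n} v i i<n with i <? n
... | yes _   = refl
... | no  i≮n = ⊥-elim (i≮n i<n)

ext-lookup : ∀ {n} (v : Vec ℕ n) (i : Fin n) → ext v (toℕ i) ≡ lookup v i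
ext-lookup v i = trans (ext-fromℕ< v (toℕ i) (toℕ<n i)) (cong (lookup v) (fromℕ<-toℕ i (toℕ<n i)))

ext-≥ : ∀ {n} (v : Vec ℕ n) i → n ≤ i → ext v i ≡ 0
ext-≥ {n} v i n≤i with i <? n
... | yes i<n = ⊥-elim (<⇒≱ i<n n≤i)
... | no  _   = refl

ext-tabulate : ∀ {n} (g : ℕ → ℕ) r → r < n → ext (tabulate {n = n} (g ∘ toℕ)) r ≡ g r
ext-tabulate {n} g r r<n =
  trans (ext-fromℕ< _ r r<n) (trans (lookup∘tabulate (g ∘ toℕ) (fromℕ< r<n)) (cong g (toℕ-fromℕ< r<n)))

module Abacus (t′ k : ℕ) where

  t : ℕ
  t = suc t′

  position : ℕ → ℕ → ℕ
  position r q = r + q * t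

  position-/ : ∀ r q → r < t → position r q / t ≡ q
  position-/ r q r<t = trans (+-distrib-/-∣ʳ r {q * t} {t} (divides q refl)) (cong₂ _+_ (m<n⇒m/n≡0 r<t) (m*n/n≡m q t))

  position-% : ∀ r q → r < t → position r q % t ≡ r
  position-% r q r<t = trans ([m+kn]%n≡m%n r q t) (m<n⇒m%n≡m r<t)

  position-%/ : ∀ p → position (p % t) (p / t) ≡ p
  position-%/ p = sym (m≡m%n+[m/n]*n p t)

  position-< : ∀ r q → r < t → q < k → position r q < k * t
  position-< r q r<t q<k = <-≤-trans (+-monoˡ-< (q * t) r<t) (*-monoˡ-≤ t q<k)

  position-suc∸t : ∀ r q → position r (suc q) ∸ t ≡ position r q
  position-suc∸t r q = trans (cong (_∸ t) (x∙yz≈y∙xz r t (q * t))) (m+n∸m≡n t (position r q))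

  beadAt : (ℕ → ℕ) → ℕ → Bool
  beadAt c p = (p / t) <ᵇ c (p % t)

  beadAt-position : ∀ c r q → r < t → beadAt c (position r q) ≡ (q <ᵇ c r)
  beadAt-position c r q r<t rewrite position-/ r q r<t | position-% r q r<t = refl

  beadAt-cong : ∀ {c c′} → (∀ r → r < t → c r ≡ c′ r) → ∀ p → beadAt c p ≡ beadAt c′ p
  beadAt-cong c≗c′ p = cong (p / t <ᵇ_) (c≗c′ (p % t) (m%n<n p t))

  beadAt-∸t : ∀ c x → t ≤ x → beadAt c x ≡ true → beadAt c (x ∸ t) ≡ true
  beadAt-∸t c x t≤x bead = begin
    beadAt c (x ∸ t)              ≡⟨ cong (beadAt c) x∸t≡ ⟩
    beadAt c (position r q)       ≡⟨ beadAt-position c r q (m%n<n x t) ⟩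
    q <ᵇ c r                      ≡⟨ <ᵇ-true (<-trans (n<1+n q) 1+q<cr) ⟩
    true                          ∎
    where
    open ≡-Reasoning
    r : ℕ
    r = x % t
    q : ℕ
    q = x / t ∸ 1
    x/t≡1+q : x / t ≡ suc q
    x/t≡1+q = sym (m+[n∸m]≡n (m≥n⇒m/n>0 t≤x))
    1+q<cr : suc q < c r
    1+q<cr = <ᵇ-true⇒< (suc q) (c r) (subst (λ q′ → (q′ <ᵇ c r) ≡ true) x/t≡1+q bead)
    x∸t≡ : x ∸ t ≡ position r q
    x∸t≡ = trans (cong (_∸ t) (trans (sym (position-%/ x)) (cong (position r) x/t≡1+q))) (position-suc∸t r q)

  runnerCount : List ℕ → ℕ → ℕ
  runnerCount xs r = sumBelow k (λ q → 𝟙 (position r q ∈ᵇ xs))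

  runner-downwardClosed : ∀ xs r → ∸-Closed t xs → DownwardClosed (λ q → position r q ∈ᵇ xs)
  runner-downwardClosed xs r closed {q} {q′} q′≤q = go q q′≤q
    where
    go : ∀ q → q′ ≤ q → (position r q ∈ᵇ xs) ≡ true → (position r q′ ∈ᵇ xs) ≡ true
    go q q′≤q bead with m≤n⇒m<n∨m≡n q′≤q
    ... | inj₂ refl = bead
    go (suc q) _ bead | inj₁ q′<1+q =
      go q (≤-pred q′<1+q) (subst (λ p → (p ∈ᵇ xs) ≡ true) (position-suc∸t r q)
        (closed _ bead (≤-trans (m≤m+n t (q * t)) (m≤n+m _ r))))

  firstRunner-empty : ∀ xs → ∸-Closed t xs → All (0 <_) xs → ∀ q → (position 0 q ∈ᵇ xs) ≡ false
  firstRunner-empty xs closed 0<xs q with position 0 q ∈ᵇ xs in bead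
  ... | false = refl
  ... | true with () ← trans (sym (runner-downwardClosed xs 0 closed {q} {0} z≤n bead)) (∉ᵇ (All.map <⇒≢ 0<xs))

  beadAt-runnerCount : ∀ xs → ∸-Closed t xs → ∀ p → p < k * t → beadAt (runnerCount xs) p ≡ (p ∈ᵇ xs)
  beadAt-runnerCount xs closed p p<N = begin
    p / t <ᵇ runnerCount xs (p % t)
      ≡⟨ downwardClosed⇒initialSegment k _ (runner-downwardClosed xs (p % t) closed) (p / t) (m<n*o⇒m/o<n p<N) ⟨
    position (p % t) (p / t) ∈ᵇ xs   ≡⟨ cong (_∈ᵇ xs) (position-%/ p) ⟩
    p ∈ᵇ xs                          ∎
    where open ≡-Reasoning

  runnerCount-beads : ∀ c r → r < t → c r ≤ k → runnerCount (filterBelow (beadAt c) (k * t)) r ≡ c r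
  runnerCount-beads c r r<t cr≤k = trans (sumBelow-cong k bead≡) (count-<ᵇ k (c r) cr≤k)
    where
    bead≡ : ∀ q → q < k → 𝟙 (position r q ∈ᵇ filterBelow (beadAt c) (k * t)) ≡ 𝟙 (q <ᵇ c r)
    bead≡ q q<k rewrite ∈ᵇ-filterBelow (beadAt c) (k * t) (position r q)
                      | beadAt-position c r q r<t | <ᵇ-true (position-< r q r<t q<k) = cong 𝟙 (∧-identityʳ _)

  runStarts≡rise : ∀ c → c 0 ≡ 0 → c t ≡ 0 → (∀ r → r < t → c r ≤ k) →
    sumBelow (k * t) (runStart (beadAt c)) ≡ rise t c
  runStarts≡rise c c0 ct c≤k = begin
    sumBelow (k * t) (runStart (beadAt c))
      ≡⟨ sumBelow-blocks k t _ ⟩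
    sumBelow k (λ q → sumBelow t (λ r → runStart (beadAt c) (position r q)))
      ≡⟨ sumBelow-swap k t (λ r q → runStart (beadAt c) (position r q)) ⟩
    sumBelow t (λ r → sumBelow k (λ q → runStart (beadAt c) (position r q)))
      ≡⟨ sumBelow-suc t′ _ ⟩
    sumBelow k (λ q → runStart (beadAt c) (position 0 q))
      + sumBelow t′ (λ i → sumBelow k (λ q → runStart (beadAt c) (position (suc i) q)))
      ≡⟨ cong₂ _+_ (sumBelow-zero k (λ q _ → runner0 q)) (sumBelow-cong t′ (λ i i<t′ → runner i (s≤s i<t′))) ⟩
    rise t′ c
      ≡⟨ +-identityʳ _ ⟨
    rise t′ c + 0
      ≡⟨ cong (rise t′ c +_) (trans (cong (_∸ c t′) ct) (0∸n≡0 (c t′))) ⟨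
    rise t c ∎
    where
    open ≡-Reasoning
    runner0 : ∀ q → runStart (beadAt c) (position 0 q) ≡ 0
    runner0 q rewrite beadAt-position c 0 q z<s | c0 | <ᵇ-false {q} {0} z≤n = refl
    runner : ∀ i → suc i < t → sumBelow k (λ q → runStart (beadAt c) (position (suc i) q)) ≡ c (suc i) ∸ c i
    runner i 1+i<t = trans
      (sumBelow-cong k (λ q _ → cong₂ (λ b b′ → 𝟙 (b ∧ not b′))
                                      (beadAt-position c (suc i) q 1+i<t) (beadAt-position c i q i<t)))
      (count-between k (c (suc i)) (c i) (c≤k (suc i) 1+i<t) (c≤k i i<t))
      where
      i<t : i < t
      i<t = <-trans (n<1+n i) 1+i<t

  beads-∸-closed : ∀ c → ∸-Closed t (filterBelow (beadAt c) (k * t))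
  beads-∸-closed c x x∈ t≤x with ∈ᵇ-filterBelow⁻ (beadAt c) (k * t) x x∈
  ... | bead , x<N = ∈ᵇ-filterBelow⁺ (beadAt c) (k * t) (x ∸ t) (beadAt-∸t c x t≤x bead) (≤-<-trans (m∸n≤m x t) x<N)

  corners-beads : ∀ c → c 0 ≡ 0 → c t ≡ 0 → (∀ r → r < t → c r ≤ k) →
    ∀ l → beta l ≡ filterBelow (beadAt c) (k * t) → corners l ≡ rise t c
  corners-beads c c0 ct c≤k l beads = begin
    corners l                                   ≡⟨ corners≡runs l ⟩
    runs (beta l)                               ≡⟨ cong runs beads ⟩
    runs (filterBelow (beadAt c) (k * t))       ≡⟨ runs-filterBelow (beadAt c) noBeadAt0 (k * t) ⟩
    sumBelow (k * t) (runStart (beadAt c))      ≡⟨ runStarts≡rise c c0 ct c≤k ⟩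
    rise t c                                    ∎
    where
    open ≡-Reasoning
    noBeadAt0 : beadAt c 0 ≡ false
    noBeadAt0 rewrite beadAt-position c 0 0 z<s | c0 = refl

  hookBound⇒bounded : ∀ l → IsPartition l → HookBound k t l → All (_< k * t) (beta l)
  hookBound⇒bounded []      _ _  = []
  hookBound⇒bounded (a ∷ l) P hb = β<N ∷ All-<-weaken (<⇒≤ β<N) (beta<head P)
    where
    β<N : a + length l < k * t
    β<N = subst (_< k * t) (hook-corner P) (hb (All.head (proj₁ P)))

  bounded⇒hookBound : ∀ l → IsPartition l → All (_< k * t) (beta l) → HookBound k t l
  bounded⇒hookBound (a ∷ l) P (β<N ∷ _) _ = subst (_< k * t) (sym (hook-corner P)) β<N

  abacus : List ℕ → Vec ℕ t
  abacus l = tabulate (runnerCount (beta l) ∘ toℕ)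

  fromAbacus : Vec ℕ t → List ℕ
  fromAbacus c = unbeta (filterBelow (beadAt (ext c)) (k * t))

  module _ {m l} (A : PredA t m k l) where

    private
      P : IsPartition l
      P = proj₁ A
      closed : ∸-Closed t (beta l)
      closed = isCore⇒∸-closed t z<s l P (proj₁ (proj₂ A))
      c : ℕ → ℕ
      c = ext (abacus l)

      c≡runnerCount : ∀ r → r < t → c r ≡ runnerCount (beta l) r
      c≡runnerCount = ext-tabulate (runnerCount (beta l))

      c0 : c 0 ≡ 0
      c0 = trans (c≡runnerCount 0 z<s)
             (sumBelow-zero k (λ q _ → cong 𝟙 (firstRunner-empty (beta l) closed (proj₂ (beta-isBetaSet l P)) q)))

      c≤k : ∀ r → r < t → c r ≤ k
      c≤k r r<t = subst (_≤ k) (sym (c≡runnerCount r r<t)) (count-≤ k _)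

    beads-abacus : filterBelow (beadAt c) (k * t) ≡ beta l
    beads-abacus = begin
      filterBelow (beadAt c) (k * t)                         ≡⟨ filterBelow-cong (k * t) (λ p _ → beadAt-cong c≡runnerCount p) ⟩
      filterBelow (beadAt (runnerCount (beta l))) (k * t)    ≡⟨ filterBelow-cong (k * t) (beadAt-runnerCount (beta l) closed) ⟩
      filterBelow (_∈ᵇ beta l) (k * t)                       ≡⟨ filterBelow-∈ᵇ (k * t) (beta l) (proj₁ (beta-isBetaSet l P))
                                                                  (hookBound⇒bounded l P (proj₂ (proj₂ (proj₂ A)))) ⟩
      beta l                                                 ∎
      where open ≡-Reasoning

    fromAbacus-abacus : fromAbacus (abacus l) ≡ l
    fromAbacus-abacus = trans (cong unbeta beads-abacus) (unbeta-beta l)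

    abacus-PredB : PredB t m k (abacus l)
    abacus-PredB =
        (λ i i≡0 → trans (sym (ext-lookup (abacus l) i)) (trans (cong c i≡0) c0))
      , (λ i → subst (_≤ k) (ext-lookup (abacus l) i) (c≤k (toℕ i) (toℕ<n i)))
      , (begin
          sum1 t (λ i → ∣ c i - c (i ∸ 1) ∣) ≡⟨ sum1-∣Δ∣≡2*rise c t c0 (ext-≥ (abacus l) t ≤-refl) ⟩
          2 * rise t c                      ≡⟨ cong (2 *_) (corners-beads c c0 (ext-≥ (abacus l) t ≤-refl) c≤k l (sym beads-abacus)) ⟨
          2 * corners l                     ≡⟨ cong (2 *_) (proj₁ (proj₂ (proj₂ A))) ⟩
          2 * m                             ∎)
      where open ≡-Reasoning

  module _ {m c} (B : PredB t m k c) where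

    private
      c′ : ℕ → ℕ
      c′ = ext c
      beads : List ℕ
      beads = filterBelow (beadAt c′) (k * t)
      l : List ℕ
      l = fromAbacus c

      c′0 : c′ 0 ≡ 0
      c′0 = trans (ext-lookup c Fin.zero) (proj₁ B Fin.zero refl)

      c′t : c′ t ≡ 0
      c′t = ext-≥ c t ≤-refl

      c′≤k : ∀ r → r < t → c′ r ≤ k
      c′≤k r r<t = subst (_≤ k) (sym (ext-fromℕ< c r r<t)) (proj₁ (proj₂ B) (fromℕ< r<t))

      beads-isBetaSet : IsBetaSet beads
      beads-isBetaSet = filterBelow-decreasing (beadAt c′) (k * t) , filterBelow-positive (beadAt c′) noBeadAt0 (k * t)
        where
        noBeadAt0 : beadAt c′ 0 ≡ false
        noBeadAt0 rewrite beadAt-position c′ 0 0 z<s | c′0 = refl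

      beta-fromAbacus : beta l ≡ beads
      beta-fromAbacus = beta-unbeta beads beads-isBetaSet

      P : IsPartition l
      P = unbeta-isPartition beads beads-isBetaSet

    fromAbacus-PredA : PredA t m k l
    fromAbacus-PredA =
        P
      , ∸-closed⇒isCore t z<s l P (subst (∸-Closed t) (sym beta-fromAbacus) (beads-∸-closed c′))
      , trans (corners-beads c′ c′0 c′t c′≤k l beta-fromAbacus)
              (*-cancelˡ-≡ _ _ 2 (trans (sym (sum1-∣Δ∣≡2*rise c′ t c′0 c′t)) (proj₂ (proj₂ B))))
      , bounded⇒hookBound l P (subst (All (_< k * t)) (sym beta-fromAbacus) (filterBelow-bounded (beadAt c′) (k * t)))

    abacus-fromAbacus : abacus l ≡ c
    abacus-fromAbacus = trans (tabulate-cong runner≡) (tabulate∘lookup c)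
      where
      runner≡ : ∀ i → runnerCount (beta l) (toℕ i) ≡ lookup c i
      runner≡ i = trans (cong (λ xs → runnerCount xs (toℕ i)) beta-fromAbacus)
                   (trans (runnerCount-beads c′ (toℕ i) (toℕ<n i) (c′≤k (toℕ i) (toℕ<n i))) (ext-lookup c i))

-- Walks in a strip

-- Only up steps check the bound k; the other heights stay below k as long as the walk starts at a height ≤ k.
data StripWalk (k : ℕ) : ℕ → List Step → Set where
  end  : StripWalk k 0 []
  up   : ∀ {h p} → suc h ≤ k → StripWalk k (suc h) p → StripWalk k h (u ∷ p)
  down : ∀ {h p} → StripWalk k h p → StripWalk k (suc h) (d ∷ p)
  flat : ∀ {h p} → StripWalk k h p → StripWalk k h (f ∷ p)

stepZ-u : ∀ h → ℤ.+ h ℤ.+ stepZ u ≡ ℤ.+ suc h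
stepZ-u h = cong ℤ.+_ (+-comm h 1)

stepZ-f : ∀ h → ℤ.+ h ℤ.+ stepZ f ≡ ℤ.+ h
stepZ-f h = cong ℤ.+_ (+-identityʳ h)

walk-nonnegative : ∀ {k h p} → StripWalk k h p → All (0ℤ ℤ.≤_) (heightsFrom (ℤ.+ h) p)
walk-nonnegative end                    = []
walk-nonnegative {h = h} (up _ w) rewrite stepZ-u h = ℤ.+≤+ z≤n ∷ walk-nonnegative w
walk-nonnegative (down w)               = ℤ.+≤+ z≤n ∷ walk-nonnegative w
walk-nonnegative {h = h} (flat w) rewrite stepZ-f h = ℤ.+≤+ z≤n ∷ walk-nonnegative w

walk-bounded : ∀ {k h p} → h ≤ k → StripWalk k h p → All (ℤ._≤ ℤ.+ k) (heightsFrom (ℤ.+ h) p)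
walk-bounded _ end                         = []
walk-bounded {h = h} _ (up 1+h≤k w) rewrite stepZ-u h = ℤ.+≤+ 1+h≤k ∷ walk-bounded 1+h≤k w
walk-bounded 1+h≤k (down w)                = ℤ.+≤+ h≤k ∷ walk-bounded h≤k w
  where h≤k = ≤-trans (n≤1+n _) 1+h≤k
walk-bounded {h = h} h≤k (flat w) rewrite stepZ-f h = ℤ.+≤+ h≤k ∷ walk-bounded h≤k w

walk-returns : ∀ {k h p} → StripWalk k h p → finalHeight (ℤ.+ h) p ≡ 0ℤ
walk-returns end                      = refl
walk-returns {h = h} (up _ w) rewrite stepZ-u h = walk-returns w
walk-returns (down w)                 = walk-returns w
walk-returns {h = h} (flat w) rewrite stepZ-f h = walk-returns w

heights⇒walk : ∀ {k} h p → All (0ℤ ℤ.≤_) (heightsFrom (ℤ.+ h) p) → All (ℤ._≤ ℤ.+ k) (heightsFrom (ℤ.+ h) p) →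
  finalHeight (ℤ.+ h) p ≡ 0ℤ → StripWalk k h p
heights⇒walk h []      _  _  returns with refl ← ℤ.+-injective returns = end
heights⇒walk h (u ∷ p) (_ ∷ nonneg) (1+h≤k ∷ bounded) returns rewrite stepZ-u h with 1+h≤k
... | ℤ.+≤+ 1+h≤k = up 1+h≤k (heights⇒walk (suc h) p nonneg bounded returns)
heights⇒walk (suc h) (d ∷ p) (_ ∷ nonneg) (_ ∷ bounded) returns = down (heights⇒walk h p nonneg bounded returns)
heights⇒walk h (f ∷ p) (_ ∷ nonneg) (_ ∷ bounded) returns rewrite stepZ-f h = flat (heights⇒walk h p nonneg bounded returns)

-- Paths through prescribed flat heights

segment : ℕ → ℕ → List Step
segment a b = replicate (b ∸ a) u ++ replicate (a ∸ b) d

segment-view : ∀ a b → (∃ λ n → b ≡ n + a × segment a b ≡ replicate n u)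
                     ⊎ (∃ λ n → a ≡ n + b × segment a b ≡ replicate n d)
segment-view a b with ≤-total a b
... | inj₁ a≤b rewrite m≤n⇒m∸n≡0 a≤b = inj₁ (b ∸ a , sym (m∸n+n≡m a≤b) , ++-identityʳ _)
... | inj₂ b≤a rewrite m≤n⇒m∸n≡0 b≤a = inj₂ (a ∸ b , sym (m∸n+n≡m b≤a) , refl)

segment-up : ∀ h x → h < x → segment h x ≡ u ∷ segment (suc h) x
segment-up h (suc x) (s≤s h≤x) rewrite +-∸-assoc 1 h≤x | m≤n⇒m∸n≡0 (m≤n⇒m≤1+n h≤x) | m≤n⇒m∸n≡0 h≤x = refl

segment-down : ∀ h x → x ≤ h → segment (suc h) x ≡ d ∷ segment h x
segment-down h x x≤h rewrite m≤n⇒m∸n≡0 (m≤n⇒m≤1+n x≤h) | m≤n⇒m∸n≡0 x≤h | +-∸-assoc 1 x≤h = refl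

flatHeights : ℕ → List Step → List ℕ
flatHeights h []      = []
flatHeights h (u ∷ p) = flatHeights (suc h) p
flatHeights h (d ∷ p) = flatHeights (h ∸ 1) p
flatHeights h (f ∷ p) = h ∷ flatHeights h p

flatHeights-ups : ∀ n a p → flatHeights a (replicate n u ++ p) ≡ flatHeights (n + a) p
flatHeights-ups zero    a p = refl
flatHeights-ups (suc n) a p = trans (flatHeights-ups n (suc a) p) (cong (λ h → flatHeights h p) (+-suc n a))

flatHeights-downs : ∀ n a p → flatHeights (n + a) (replicate n d ++ p) ≡ flatHeights a p
flatHeights-downs zero    a p = refl
flatHeights-downs (suc n) a p = flatHeights-downs n a p

flatHeights-segment : ∀ a b p → flatHeights a (segment a b ++ p) ≡ flatHeights b p
flatHeights-segment a b p with segment-view a b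
... | inj₁ (n , refl , seg) rewrite seg = flatHeights-ups n a p
... | inj₂ (n , refl , seg) rewrite seg = flatHeights-downs n b p

length-flatHeights : ∀ h p → length (flatHeights h p) ≡ flats p
length-flatHeights h []      = refl
length-flatHeights h (u ∷ p) = length-flatHeights (suc h) p
length-flatHeights h (d ∷ p) = length-flatHeights (h ∸ 1) p
length-flatHeights h (f ∷ p) = cong suc (length-flatHeights h p)

flats-replicate : ∀ {s} → s ≢ f → ∀ n p → flats (replicate n s ++ p) ≡ flats p
flats-replicate     _   zero    p = refl
flats-replicate {u} s≢f (suc n) p = flats-replicate s≢f n p
flats-replicate {d} s≢f (suc n) p = flats-replicate s≢f n p
flats-replicate {f} s≢f (suc n) p = ⊥-elim (s≢f refl)

flats-segment : ∀ a b p → flats (segment a b ++ p) ≡ flats p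
flats-segment a b p with segment-view a b
... | inj₁ (n , _ , seg) rewrite seg = flats-replicate (λ ()) n p
... | inj₂ (n , _ , seg) rewrite seg = flats-replicate (λ ()) n p

length-segment : ∀ a b → length (segment a b) ≡ ∣ b - a ∣
length-segment a b with segment-view a b
... | inj₁ (n , refl , seg) rewrite seg =
  trans (length-replicate n) (sym (trans (∣-∣-comm (n + a) a) (trans (cong (∣ a -_∣) (+-comm n a)) (∣m-m+n∣≡n a n))))
... | inj₂ (n , refl , seg) rewrite seg =
  trans (length-replicate n) (sym (trans (cong (∣ b -_∣) (+-comm n b)) (∣m-m+n∣≡n b n)))

ups-walk : ∀ {k a p} n → n + a ≤ k → StripWalk k (n + a) p → StripWalk k a (replicate n u ++ p)
ups-walk     zero    _     w = w
ups-walk {k} {a} {p} (suc n) bound w =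
  up (≤-trans (s≤s (m≤n+m a n)) bound)
     (ups-walk n (subst (_≤ k) (sym (+-suc n a)) bound) (subst (λ h → StripWalk k h p) (sym (+-suc n a)) w))

downs-walk : ∀ {k a p} n → StripWalk k a p → StripWalk k (n + a) (replicate n d ++ p)
downs-walk zero    w = w
downs-walk (suc n) w = down (downs-walk n w)

segment-walk : ∀ {k p} a b → b ≤ k → StripWalk k b p → StripWalk k a (segment a b ++ p)
segment-walk a b b≤k w with segment-view a b
... | inj₁ (n , refl , seg) rewrite seg = ups-walk n b≤k w
... | inj₂ (n , refl , seg) rewrite seg = downs-walk n w

NoCorner : Step → Step → Set
NoCorner a b = ¬ (a ≡ u × b ≡ d) × ¬ (a ≡ d × b ≡ u)

noCorner-refl : ∀ {s} → s ≢ f → NoCorner s s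
noCorner-refl {u} _   = (λ { (_ , ()) }) , (λ { (() , _) })
noCorner-refl {d} _   = (λ { (() , _) }) , (λ { (_ , ()) })
noCorner-refl {f} s≢f = ⊥-elim (s≢f refl)

noCorner-beforeFlat : ∀ s → NoCorner s f
noCorner-beforeFlat s = (λ { (_ , ()) }) , (λ { (_ , ()) })

noCorner-afterFlat : ∀ s → NoCorner f s
noCorner-afterFlat s = (λ { (() , _) }) , (λ { (() , _) })

cornerless-flat : ∀ p → Cornerless p → Cornerless (f ∷ p)
cornerless-flat []      _ = [-]
cornerless-flat (s ∷ p) c = noCorner-afterFlat s ∷ c

cornerless-replicate : ∀ {s} → s ≢ f → ∀ n → Cornerless (replicate n s)
cornerless-replicate s≢f zero          = []
cornerless-replicate s≢f (suc zero)    = [-]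
cornerless-replicate s≢f (suc (suc n)) = noCorner-refl s≢f ∷ cornerless-replicate s≢f (suc n)

cornerless-replicate-flat : ∀ {s} → s ≢ f → ∀ n p → Cornerless (f ∷ p) → Cornerless (replicate n s ++ f ∷ p)
cornerless-replicate-flat s≢f zero          p c = c
cornerless-replicate-flat s≢f (suc zero)    p c = noCorner-beforeFlat _ ∷ c
cornerless-replicate-flat s≢f (suc (suc n)) p c = noCorner-refl s≢f ∷ cornerless-replicate-flat s≢f (suc n) p c

cornerless-segment : ∀ a b → Cornerless (segment a b)
cornerless-segment a b with segment-view a b
... | inj₁ (n , _ , seg) rewrite seg = cornerless-replicate (λ ()) n
... | inj₂ (n , _ , seg) rewrite seg = cornerless-replicate (λ ()) n

cornerless-segment-flat : ∀ a b p → Cornerless (f ∷ p) → Cornerless (segment a b ++ f ∷ p)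
cornerless-segment-flat a b p c with segment-view a b
... | inj₁ (n , _ , seg) rewrite seg = cornerless-replicate-flat (λ ()) n p c
... | inj₂ (n , _ , seg) rewrite seg = cornerless-replicate-flat (λ ()) n p c

pathFrom : ℕ → List ℕ → List Step
pathFrom h []       = segment h 0
pathFrom h (x ∷ xs) = segment h x ++ f ∷ pathFrom x xs

variation : ℕ → List ℕ → ℕ
variation h []       = ∣ 0 - h ∣
variation h (x ∷ xs) = ∣ x - h ∣ + variation x xs

flatHeights-pathFrom : ∀ h xs → flatHeights h (pathFrom h xs) ≡ xs
flatHeights-pathFrom h []       = trans (cong (flatHeights h) (sym (++-identityʳ (segment h 0)))) (flatHeights-segment h 0 [])
flatHeights-pathFrom h (x ∷ xs) = trans (flatHeights-segment h x (f ∷ pathFrom x xs)) (cong (x ∷_) (flatHeights-pathFrom x xs))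

flats-pathFrom : ∀ h xs → flats (pathFrom h xs) ≡ length xs
flats-pathFrom h []       = trans (cong flats (sym (++-identityʳ (segment h 0)))) (flats-segment h 0 [])
flats-pathFrom h (x ∷ xs) = trans (flats-segment h x (f ∷ pathFrom x xs)) (cong suc (flats-pathFrom x xs))

length-pathFrom : ∀ h xs → length (pathFrom h xs) ≡ variation h xs + length xs
length-pathFrom h []       = trans (length-segment h 0) (sym (+-identityʳ h))
length-pathFrom h (x ∷ xs) = begin
  length (segment h x ++ f ∷ pathFrom x xs)              ≡⟨ length-++ (segment h x) ⟩
  length (segment h x) + suc (length (pathFrom x xs))    ≡⟨ cong₂ (λ a b → a + suc b) (length-segment h x) (length-pathFrom x xs) ⟩
  ∣ x - h ∣ + suc (variation x xs + length xs)           ≡⟨ regroup ∣ x - h ∣ (variation x xs) (length xs) ⟩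
  ∣ x - h ∣ + variation x xs + suc (length xs)           ∎
  where
  open ≡-Reasoning
  regroup : ∀ a v n → a + suc (v + n) ≡ a + v + suc n
  regroup = solve-∀

cornerless-pathFrom : ∀ h xs → Cornerless (pathFrom h xs)
cornerless-pathFrom h []       = cornerless-segment h 0
cornerless-pathFrom h (x ∷ xs) = cornerless-segment-flat h x (pathFrom x xs) (cornerless-flat _ (cornerless-pathFrom x xs))

pathFrom-walk : ∀ {k} h xs → All (_≤ k) xs → StripWalk k h (pathFrom h xs)
pathFrom-walk h []       _             = subst (StripWalk _ h) (++-identityʳ (segment h 0)) (segment-walk h 0 z≤n end)
pathFrom-walk h (x ∷ xs) (x≤k ∷ xs≤k) = segment-walk h x x≤k (flat (pathFrom-walk x xs xs≤k))

firstOr0 : List ℕ → ℕ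
firstOr0 []      = 0
firstOr0 (x ∷ _) = x

pathFrom-up : ∀ h xs → h < firstOr0 xs → pathFrom h xs ≡ u ∷ pathFrom (suc h) xs
pathFrom-up h (x ∷ xs) h<x = cong (_++ f ∷ pathFrom x xs) (segment-up h x h<x)

pathFrom-down : ∀ h xs → firstOr0 xs ≤ h → pathFrom (suc h) xs ≡ d ∷ pathFrom h xs
pathFrom-down h []       _   = segment-down h 0 z≤n
pathFrom-down h (x ∷ xs) x≤h = cong (_++ f ∷ pathFrom x xs) (segment-down h x x≤h)

-- Without corners, a run of up steps continues until the next flat step, which is therefore higher.
firstFlat-afterUp : ∀ {k h p} → StripWalk k (suc h) p → Cornerless (u ∷ p) → h < firstOr0 (flatHeights (suc h) p)
firstFlat-afterUp (up _ w)  (_ ∷ c)               = <-trans (n<1+n _) (firstFlat-afterUp w c)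
firstFlat-afterUp (down w)  ((up-down , _) ∷ _)   = ⊥-elim (up-down (refl , refl))
firstFlat-afterUp (flat w)  _                      = ≤-refl

firstFlat-afterDown : ∀ {k h p} → StripWalk k h p → Cornerless (d ∷ p) → firstOr0 (flatHeights h p) ≤ h
firstFlat-afterDown end       _                    = z≤n
firstFlat-afterDown (up _ w)  ((_ , down-up) ∷ _)  = ⊥-elim (down-up (refl , refl))
firstFlat-afterDown (down w)  (_ ∷ c)              = m≤n⇒m≤1+n (firstFlat-afterDown w c)
firstFlat-afterDown (flat w)  _                     = ≤-refl

pathFrom-flatHeights : ∀ {k h p} → StripWalk k h p → Cornerless p → pathFrom h (flatHeights h p) ≡ p
pathFrom-flatHeights end _ = refl
pathFrom-flatHeights {h = h} {u ∷ p} (up _ w) c =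
  trans (pathFrom-up h (flatHeights (suc h) p) (firstFlat-afterUp w c)) (cong (u ∷_) (pathFrom-flatHeights w (Linked.tail c)))
pathFrom-flatHeights {h = suc h} {d ∷ p} (down w) c =
  trans (pathFrom-down h (flatHeights h p) (firstFlat-afterDown w c)) (cong (d ∷_) (pathFrom-flatHeights w (Linked.tail c)))
pathFrom-flatHeights {h = h} {f ∷ p} (flat w) c rewrite n∸n≡0 h =
  cong (f ∷_) (pathFrom-flatHeights w (Linked.tail c))

flatHeights-bounded : ∀ {k h p} → h ≤ k → StripWalk k h p → All (_≤ k) (flatHeights h p)
flatHeights-bounded _     end          = []
flatHeights-bounded _     (up 1+h≤k w) = flatHeights-bounded 1+h≤k w
flatHeights-bounded 1+h≤k (down w)     = flatHeights-bounded (≤-trans (n≤1+n _) 1+h≤k) w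
flatHeights-bounded h≤k   (flat w)     = h≤k ∷ flatHeights-bounded h≤k w

flatFree-even : ∀ {k h p} → StripWalk k h p → flats p ≡ 0 → ∃ λ j → length p + h ≡ 2 * j
flatFree-even end _ = 0 , refl
flatFree-even {h = h} {u ∷ p} (up _ w) no-flats with flatFree-even w no-flats
... | j , e = j , trans (sym (+-suc (length p) h)) e
flatFree-even {h = suc h} {d ∷ p} (down w) no-flats with flatFree-even w no-flats
... | j , e = suc j , trans (cong suc (+-suc (length p) h)) (trans (cong (suc ∘ suc) e) (sym (*-suc 2 j)))
flatFree-even (flat w) ()

padTo : (n : ℕ) → List ℕ → Vec ℕ n
padTo zero    _        = []ᵥ
padTo (suc n) []       = 0 ∷ᵥ padTo n []
padTo (suc n) (x ∷ xs) = x ∷ᵥ padTo n xs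

padTo-toList : ∀ {n} (v : Vec ℕ n) → padTo n (toList v) ≡ v
padTo-toList []ᵥ       = refl
padTo-toList (x ∷ᵥ v) = cong (x ∷ᵥ_) (padTo-toList v)

toList-padTo : ∀ n xs → length xs ≡ n → toList (padTo n xs) ≡ xs
toList-padTo zero    []       _    = refl
toList-padTo (suc n) (x ∷ xs) refl = cong (x ∷_) (toList-padTo n xs refl)

lookup-padTo-≤ : ∀ {k} n xs → All (_≤ k) xs → ∀ i → lookup (padTo n xs) i ≤ k
lookup-padTo-≤ (suc n) []       _            Fin.zero    = z≤n
lookup-padTo-≤ (suc n) []       _            (Fin.suc i) = lookup-padTo-≤ n [] [] i
lookup-padTo-≤ (suc n) (x ∷ xs) (x≤k ∷ _)    Fin.zero    = x≤k
lookup-padTo-≤ (suc n) (x ∷ xs) (_ ∷ xs≤k)  (Fin.suc i) = lookup-padTo-≤ n xs xs≤k i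

toList-bounded : ∀ {k n} (v : Vec ℕ n) → (∀ i → lookup v i ≤ k) → All (_≤ k) (toList v)
toList-bounded []ᵥ       _   = []
toList-bounded (x ∷ᵥ v) v≤k = v≤k Fin.zero ∷ toList-bounded v (v≤k ∘ Fin.suc)

ext-cons-zero : ∀ {n} x (v : Vec ℕ n) → ext (x ∷ᵥ v) 0 ≡ x
ext-cons-zero x v = ext-fromℕ< (x ∷ᵥ v) 0 z<s

ext-cons-suc : ∀ {n} x (v : Vec ℕ n) i → ext (x ∷ᵥ v) (suc i) ≡ ext v i
ext-cons-suc {n} x v i = case i <? n of λ where
  (yes i<n) → trans (ext-fromℕ< (x ∷ᵥ v) (suc i) (s≤s i<n)) (sym (ext-fromℕ< v i i<n))
  (no  i≮n) → trans (ext-≥ (x ∷ᵥ v) (suc i) (s≤s (≮⇒≥ i≮n))) (sym (ext-≥ v i (≮⇒≥ i≮n)))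

sumBelow-∣Δ∣≡variation : ∀ {n} h (v : Vec ℕ n) →
  sumBelow (suc n) (λ i → ∣ ext (h ∷ᵥ v) (suc i) - ext (h ∷ᵥ v) i ∣) ≡ variation h (toList v)
sumBelow-∣Δ∣≡variation h []ᵥ       = refl
sumBelow-∣Δ∣≡variation {suc n} h (x ∷ᵥ v) = begin
  sumBelow (suc (suc n)) Δ                          ≡⟨ sumBelow-suc (suc n) Δ ⟩
  Δ 0 + sumBelow (suc n) (Δ ∘ suc)                  ≡⟨ cong₂ _+_ Δ0 (sumBelow-cong (suc n) (λ i _ → Δ-suc i)) ⟩
  ∣ x - h ∣ + sumBelow (suc n) (λ i → ∣ ext (x ∷ᵥ v) (suc i) - ext (x ∷ᵥ v) i ∣)
                                                    ≡⟨ cong (∣ x - h ∣ +_) (sumBelow-∣Δ∣≡variation x v) ⟩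
  ∣ x - h ∣ + variation x (toList v)                ∎
  where
  open ≡-Reasoning
  Δ : ℕ → ℕ
  Δ i = ∣ ext (h ∷ᵥ x ∷ᵥ v) (suc i) - ext (h ∷ᵥ x ∷ᵥ v) i ∣
  Δ0 : Δ 0 ≡ ∣ x - h ∣
  Δ0 = cong₂ ∣_-_∣ (trans (ext-cons-suc h (x ∷ᵥ v) 0) (ext-cons-zero x v)) (ext-cons-zero h (x ∷ᵥ v))
  Δ-suc : ∀ i → Δ (suc i) ≡ ∣ ext (x ∷ᵥ v) (suc i) - ext (x ∷ᵥ v) i ∣
  Δ-suc i = cong₂ ∣_-_∣ (ext-cons-suc h (x ∷ᵥ v) (suc i)) (ext-cons-suc h (x ∷ᵥ v) i)

sum1-∣Δ∣≡variation : ∀ {n} h (v : Vec ℕ n) →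
  sum1 (suc n) (λ i → ∣ ext (h ∷ᵥ v) i - ext (h ∷ᵥ v) (i ∸ 1) ∣) ≡ variation h (toList v)
sum1-∣Δ∣≡variation {n} h v = trans (sum1≡sumBelow (suc n) _) (sumBelow-∣Δ∣≡variation h v)

-- The bijections

subsetBijection : ∀ {A B : Set} {P : A → Set} {Q : B → Set} (to : A → B) (from : B → A) →
  (∀ {x} → P x → Q (to x)) → (∀ {y} → Q y → P (from y)) →
  (∀ {x} → P x → from (to x) ≡ x) → (∀ {y} → Q y → to (from y) ≡ y) →
  Bijection (SubSetoid A P) (SubSetoid B Q)
subsetBijection {A} {B} {P} {Q} to from to-Q from-P from∘to to∘from = record
  { to        = λ (x , Px) → to x , to-Q Px
  ; cong      = cong to
  ; bijective = (λ {x} {y} → injective {x} {y}) , surjective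
  }
  where
  injective : ∀ {x y : Σ A P} → to (proj₁ x) ≡ to (proj₁ y) → proj₁ x ≡ proj₁ y
  injective {x , Px} {y , Py} e = trans (sym (from∘to Px)) (trans (cong from e) (from∘to Py))
  surjective : ∀ (y : Σ B Q) → Σ (Σ A P) λ x → ∀ {z : Σ A P} → proj₁ z ≡ proj₁ x → to (proj₁ z) ≡ proj₁ y
  surjective (y , Qy) = (from y , from-P Qy) , λ e → trans (cong to e) (to∘from Qy)

2*m≡0⇒m≡0 : ∀ m → 0 ≡ 2 * m → m ≡ 0
2*m≡0⇒m≡0 zero _ = refl

partitions-t=0 : ∀ {m k l} → PredA 0 m k l → l ≡ [] × m ≡ 0
partitions-t=0 {k = k} {a ∷ l} (P , _ , _ , hookBound) =
  ⊥-elim (n≮0 (subst (hook (a ∷ l) 0 0 <_) (*-zeroʳ k) (hookBound (All.head (proj₁ P)))))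
partitions-t=0 {l = []} (_ , _ , corners≡m , _) = refl , sym corners≡m

paths-t=0 : ∀ {m k p} → PredC 0 m k p → p ≡ [] × m ≡ 0
paths-t=0 {m} {k} {p} ((nonneg , returns) , length≡ , _ , no-flats , bounded) with m | length≡
... | zero  | length≡0 with [] ← p = refl , refl
... | suc m′ | length≡odd with flatFree-even (heights⇒walk 0 p nonneg bounded returns) no-flats
...   | j , length≡even =
  ⊥-elim (even≢odd j m′ (trans (sym length≡even) (trans (+-identityʳ _) (trans length≡odd (odd m′)))))
  where
  odd : ∀ m′ → 2 * suc m′ + 0 ∸ 1 ≡ suc (2 * m′)
  odd m′ = cong (_∸ 1) (regroup m′)
    where
    regroup : ∀ m′ → 2 * suc m′ + 0 ≡ suc (suc (2 * m′))
    regroup = solve-∀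

partitions↔sequences : ∀ t m k → Bijection (SetA t m k) (SetB t m k)
partitions↔sequences zero m k = subsetBijection (λ _ → []ᵥ) (λ _ → [])
  (λ A → (λ ()) , (λ ()) , cong (2 *_) (sym (proj₂ (partitions-t=0 {m} {k} A))))
  (λ B → ([] , []) , (λ _ _ ()) , sym (2*m≡0⇒m≡0 m (proj₂ (proj₂ B))) , (λ ()))
  (λ A → sym (proj₁ (partitions-t=0 {m} {k} A)))
  (λ { {[]ᵥ} _ → refl })
partitions↔sequences (suc t′) m k =
  subsetBijection abacus fromAbacus (abacus-PredB {m}) (fromAbacus-PredA {m}) (fromAbacus-abacus {m}) (abacus-fromAbacus {m})
  where open Abacus t′ k

toPath : ∀ {n} → Vec ℕ (suc n) → List Step
toPath (_ ∷ᵥ v) = pathFrom 0 (toList v)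

fromPath : ∀ n → List Step → Vec ℕ (suc n)
fromPath n p = 0 ∷ᵥ padTo n (flatHeights 0 p)

module Paths (t′ m k : ℕ) where

  length≡2m+t′ : ∀ (p : List Step) → length p ≡ 2 * m + suc t′ ∸ 1 → length p ≡ 2 * m + t′
  length≡2m+t′ p length≡ = trans length≡ (cong (_∸ 1) (+-suc (2 * m) t′))

  toList-padTo-flatHeights : ∀ p → flats p ≡ t′ → toList (padTo t′ (flatHeights 0 p)) ≡ flatHeights 0 p
  toList-padTo-flatHeights p no-flats = toList-padTo t′ (flatHeights 0 p) (trans (length-flatHeights 0 p) no-flats)

  toPath-PredC : ∀ {c} → PredB (suc t′) m k c → PredC (suc t′) m k (toPath c)
  toPath-PredC {x ∷ᵥ v} B with proj₁ B Fin.zero refl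
  ... | refl = (walk-nonnegative w , walk-returns w) , length≡ , cornerless-pathFrom 0 xs ,
               trans (flats-pathFrom 0 xs) (length-toList v) , walk-bounded z≤n w
    where
    xs : List ℕ
    xs = toList v
    w : StripWalk k 0 (pathFrom 0 xs)
    w = pathFrom-walk 0 xs (toList-bounded v (proj₁ (proj₂ B) ∘ Fin.suc))
    length≡ : length (pathFrom 0 xs) ≡ 2 * m + suc t′ ∸ 1
    length≡ = begin
      length (pathFrom 0 xs)     ≡⟨ length-pathFrom 0 xs ⟩
      variation 0 xs + length xs ≡⟨ cong₂ _+_ (trans (sym (sum1-∣Δ∣≡variation 0 v)) (proj₂ (proj₂ B))) (length-toList v) ⟩
      2 * m + t′                 ≡⟨ cong (_∸ 1) (+-suc (2 * m) t′) ⟨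
      2 * m + suc t′ ∸ 1         ∎
      where open ≡-Reasoning

  fromPath-PredB : ∀ {p} → PredC (suc t′) m k p → PredB (suc t′) m k (fromPath t′ p)
  fromPath-PredB {p} ((nonneg , returns) , length≡ , cornerless , no-flats , bounded) =
    first≡0 , ≤k , trans (sum1-∣Δ∣≡variation 0 (padTo t′ xs)) (trans (cong (variation 0) (toList-padTo-flatHeights p no-flats)) variation≡)
    where
    w : StripWalk k 0 p
    w = heights⇒walk 0 p nonneg bounded returns
    xs : List ℕ
    xs = flatHeights 0 p
    first≡0 : ∀ i → toℕ i ≡ 0 → lookup (fromPath t′ p) i ≡ 0
    first≡0 Fin.zero _ = refl
    ≤k : ∀ i → lookup (fromPath t′ p) i ≤ k
    ≤k Fin.zero    = z≤n
    ≤k (Fin.suc i) = lookup-padTo-≤ t′ xs (flatHeights-bounded z≤n w) i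
    variation≡ : variation 0 xs ≡ 2 * m
    variation≡ = +-cancelʳ-≡ t′ _ _ (begin
      variation 0 xs + t′           ≡⟨ cong (variation 0 xs +_) (trans (length-flatHeights 0 p) no-flats) ⟨
      variation 0 xs + length xs    ≡⟨ length-pathFrom 0 xs ⟨
      length (pathFrom 0 xs)        ≡⟨ cong length (pathFrom-flatHeights w cornerless) ⟩
      length p                      ≡⟨ length≡2m+t′ p length≡ ⟩
      2 * m + t′                    ∎)
      where open ≡-Reasoning

  toPath-fromPath : ∀ {p} → PredC (suc t′) m k p → toPath (fromPath t′ p) ≡ p
  toPath-fromPath {p} ((nonneg , returns) , _ , cornerless , no-flats , bounded) =
    trans (cong (pathFrom 0) (toList-padTo-flatHeights p no-flats))
          (pathFrom-flatHeights (heights⇒walk 0 p nonneg bounded returns) cornerless)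

  fromPath-toPath : ∀ {c} → PredB (suc t′) m k c → fromPath t′ (toPath c) ≡ c
  fromPath-toPath {x ∷ᵥ v} B with proj₁ B Fin.zero refl
  ... | refl = cong (0 ∷ᵥ_) (trans (cong (padTo t′) (flatHeights-pathFrom 0 (toList v))) (padTo-toList v))

sequences↔paths : ∀ t m k → Bijection (SetB t m k) (SetC t m k)
sequences↔paths zero m k = subsetBijection (λ _ → []) (λ _ → []ᵥ)
  (λ B → ([] , refl) , cong (λ m → 2 * m + 0 ∸ 1) (sym (2*m≡0⇒m≡0 m (proj₂ (proj₂ B)))) , [] , refl , [])
  (λ C → (λ ()) , (λ ()) , cong (2 *_) (sym (proj₂ (paths-t=0 {m} {k} C))))
  (λ { {[]ᵥ} _ → refl })
  (λ C → sym (proj₁ (paths-t=0 {m} {k} C)))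
sequences↔paths (suc t′) m k =
  subsetBijection toPath (fromPath t′) toPath-PredC fromPath-PredB fromPath-toPath toPath-fromPath
  where open Paths t′ m k

theorem3p3 : (t m k : ℕ) →
    Bijection (SetA t m k) (SetB t m k) ×
    Bijection (SetB t m k) (SetC t m k) ×
    Bijection (SetA t m k) (SetC t m k)
theorem3p3 t m k = A↔B , B↔C , bijection A↔B B↔C
  where
  A↔B : Bijection (SetA t m k) (SetB t m k)
  A↔B = partitions↔sequences t m k
  B↔C : Bijection (SetB t m k) (SetC t m k)
  B↔C = sequences↔paths t m k
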